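{- Let $\Gamma$ and $\Lambda$ be connected graphs, each on $n\ge3$ vertices, and suppose that not both of them are the complete graph $K_n$. Then the join $\Gamma\vee\Lambda$ is not a line graph.
   Context: The join $\Gamma\vee\Lambda$ of graphs with disjoint vertex sets is the graph with vertex set $V(\Gamma)\cup V(\Lambda)$ and edge set $E(\Gamma)\cup E(\Lambda)\cup\{\{u,v\}:u\in V(\Gamma),v\in V(\Lambda)\}$. A graph is a line graph if it is isomorphic to $\mathscr{L}(P)$ for some graph $P$, where $\mathscr{L}(P)$ has the edges of $P$ as vertices, two being adjacent iff they share an endpoint in $P$. -}

module Defs where

open import Level using (Level; 0ℓ; suc)
open import Data.Nat using (ℕ; _+_; _<_)
open import Data.Fin using (Fin; toℕ; splitAt)
open import Data.Sum using (_⊎_; inj₁; inj₂)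
open import Data.Product using (Σ; ∃; _×_; _,_; proj₁; proj₂)
open import Data.Empty using (⊥)
open import Data.Unit using (⊤)
open import Relation.Nullary using (¬_)
open import Relation.Binary.PropositionalEquality using (_≡_; _≢_)
open import Function.Bundles using (_⇔_)

record Graph (n : ℕ) : Set₁ where
  field
    Adj    : Fin n → Fin n → Set
    sym    : ∀ {u v} → Adj u v → Adj v u
    irrefl : ∀ {u} → ¬ Adj u u
open Graph public

data Walk {n : ℕ} (G : Graph n) : Fin n → Fin n → Set where
  here  : ∀ {u} → Walk G u u
  step  : ∀ {u v w} → Adj G u v → Walk G v w → Walk G u w

Connected : {n : ℕ} → Graph n → Set
Connected G = ∀ u v → Walk G u v

IsComplete : {n : ℕ} → Graph n → Set
IsComplete G = ∀ u v → u ≢ v → Adj G u v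

-- Join: vertex set Fin (n + m), first n vertices carry Γ, last m carry Λ,
-- and every vertex of Γ is adjacent to every vertex of Λ.
JoinAdj : {n m : ℕ} → Graph n → Graph m → Fin n ⊎ Fin m → Fin n ⊎ Fin m → Set
JoinAdj Γ Λ (inj₁ a) (inj₁ b) = Adj Γ a b
JoinAdj Γ Λ (inj₂ a) (inj₂ b) = Adj Λ a b
JoinAdj Γ Λ (inj₁ _) (inj₂ _) = ⊤
JoinAdj Γ Λ (inj₂ _) (inj₁ _) = ⊤

private
  jsym : {n m : ℕ} (Γ : Graph n) (Λ : Graph m) →
         ∀ x y → JoinAdj Γ Λ x y → JoinAdj Γ Λ y x
  jsym Γ Λ (inj₁ a) (inj₁ b) p = sym Γ p
  jsym Γ Λ (inj₂ a) (inj₂ b) p = sym Λ p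
  jsym Γ Λ (inj₁ _) (inj₂ _) p = _
  jsym Γ Λ (inj₂ _) (inj₁ _) p = _

  jirr : {n m : ℕ} (Γ : Graph n) (Λ : Graph m) →
         ∀ x → ¬ JoinAdj Γ Λ x x
  jirr Γ Λ (inj₁ a) = irrefl Γ
  jirr Γ Λ (inj₂ a) = irrefl Λ

_∨ᴳ_ : {n m : ℕ} → Graph n → Graph m → Graph (n + m)
_∨ᴳ_ {n} Γ Λ = record
  { Adj    = λ u v → JoinAdj Γ Λ (splitAt n u) (splitAt n v)
  ; sym    = λ {u} {v} → jsym Γ Λ (splitAt n u) (splitAt n v)
  ; irrefl = λ {u} → jirr Γ Λ (splitAt n u)
  }

-- An edge of P, represented canonically as an ordered pair (a , b) with a < b.
Edge : {m : ℕ} → Graph m → Set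
Edge {m} P = Σ (Fin m × Fin m) λ e → (toℕ (proj₁ e) < toℕ (proj₂ e)) × Adj P (proj₁ e) (proj₂ e)

ShareEnd : {m : ℕ} {P : Graph m} → Edge P → Edge P → Set
ShareEnd ((a , b) , _) ((c , d) , _) = (a ≡ c) ⊎ (a ≡ d) ⊎ (b ≡ c) ⊎ (b ≡ d)

IsLineGraphOf : {N m : ℕ} → Graph N → Graph m → Set
IsLineGraphOf {N} G P =
  Σ (Fin N → Edge P) λ f →
    (∀ u v → proj₁ (f u) ≡ proj₁ (f v) → u ≡ v) ×
    (∀ (e : Edge P) → ∃ λ u → proj₁ (f u) ≡ proj₁ e) ×
    (∀ u v → Adj G u v ⇔ (proj₁ (f u) ≢ proj₁ (f v) × ShareEnd {P = P} (f u) (f v)))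

IsLineGraph : {N : ℕ} → Graph N → Set₁
IsLineGraph G = Σ ℕ λ m → Σ (Graph m) λ P → IsLineGraphOf G P

-- A line graph never contains K₅ minus an edge, i.e. non-adjacent
-- vertices p, q together with a triangle x, y, z all of whose vertices are
-- adjacent to both p and q.  Indeed, in L(P) the edges X, Y, Z each meet
-- the disjoint edges A = p and B = q, so X = {αX , βX} with αX ∈ A, βX ∈ B;
-- the "cells" (αX , βX), (αY , βY), (αZ , βZ) of the 2 × 2 grid A × B are
-- pairwise distinct and pairwise share a row or a column, which is impossible.
-- On the other hand, if Γ is connected but not complete it contains an
-- induced path p – c – q, and any edge z – x of Λ completes it to a K₅ minus
-- the edge pq inside Γ ∨ Λ.  Since adjacency in a line graph is decidable,
-- a line graph Γ ∨ Λ thus forces both Γ and Λ to be complete.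
module Submission where

open import Defs hiding (sym)
open import Data.Nat using (ℕ; _≤_; _<_; s≤s)
open import Data.Nat.Properties using (<-irrefl; <-asym; ≤-trans; n≤1+n)
open import Data.Product using (_×_; _,_; proj₁; proj₂; ∃)
open import Data.Product.Properties using (≡-dec)
open import Data.Sum using (_⊎_; inj₁; inj₂)
open import Data.Empty using (⊥; ⊥-elim)
open import Relation.Nullary using (¬_; Dec; yes; no)
open import Relation.Nullary.Decidable using (¬?; _×-dec_; _⊎-dec_; map′)
open import Relation.Binary.Definitions using (DecidableEquality)
open import Relation.Binary.PropositionalEquality using (_≡_; _≢_; refl; sym; trans; subst)
open import Data.Fin using (Fin; toℕ; splitAt; _↑ˡ_; _↑ʳ_) renaming (zero to fzero; suc to fsuc)
open import Data.Fin.Properties using (splitAt-↑ˡ; splitAt-↑ʳ; ↑ˡ-injective; ↑ʳ-injective; _≟_)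
open import Function.Bundles using (_⇔_; mk⇔; Equivalence)

TwoCoincide : {T : Set} → T → T → T → Set
TwoCoincide x y z = x ≡ y ⊎ x ≡ z ⊎ y ≡ z

module Rook {Row Col : Set} where

  RookAdj : Row × Col → Row × Col → Set
  RookAdj P Q = (proj₁ P ≡ proj₁ Q ⊎ proj₂ P ≡ proj₂ Q)
              × ¬ (proj₁ P ≡ proj₁ Q × proj₂ P ≡ proj₂ Q)

  rook-sym : ∀ {P Q} → RookAdj P Q → RookAdj Q P
  rook-sym (inj₁ r , ¬rc) = inj₁ (sym r) , λ (r′ , c′) → ¬rc (sym r′ , sym c′)
  rook-sym (inj₂ c , ¬rc) = inj₂ (sym c) , λ (r′ , c′) → ¬rc (sym r′ , sym c′)

  -- In a rook triangle P Q S, P cannot share its row with Q and its column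
  -- with S: whichever line Q and S share would make P and one of them equal.
  row-and-column : ∀ {P Q S} → RookAdj P Q → RookAdj P S → RookAdj Q S →
    proj₁ P ≡ proj₁ Q → proj₂ P ≡ proj₂ S → ⊥
  row-and-column (_ , ¬PQ) (_ , ¬PS) (inj₁ rQS , _) rPQ cPS = ¬PS (trans rPQ rQS , cPS)
  row-and-column (_ , ¬PQ) (_ , ¬PS) (inj₂ cQS , _) rPQ cPS = ¬PQ (rPQ , trans cPS (sym cQS))

  -- Three pairwise rook-adjacent cells lie on one line, so either their rows
  -- or their columns are pairwise distinct.
  rook-triangle : ∀ {P Q S} → RookAdj P Q → RookAdj P S → RookAdj Q S →
    TwoCoincide (proj₁ P) (proj₁ Q) (proj₁ S) →
    TwoCoincide (proj₂ P) (proj₂ Q) (proj₂ S) → ⊥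
  rook-triangle pq ps qs (inj₁ r) (inj₁ c) = proj₂ pq (r , c)
  rook-triangle pq ps qs (inj₁ r) (inj₂ (inj₁ c)) = row-and-column pq ps qs r c
  rook-triangle pq ps qs (inj₁ r) (inj₂ (inj₂ c)) =
    row-and-column (rook-sym pq) qs ps (sym r) c
  rook-triangle pq ps qs (inj₂ (inj₁ r)) (inj₁ c) =
    row-and-column ps pq (rook-sym qs) r c
  rook-triangle pq ps qs (inj₂ (inj₁ r)) (inj₂ (inj₁ c)) = proj₂ ps (r , c)
  rook-triangle pq ps qs (inj₂ (inj₁ r)) (inj₂ (inj₂ c)) =
    row-and-column (rook-sym ps) (rook-sym qs) pq (sym r) (sym c)
  rook-triangle pq ps qs (inj₂ (inj₂ r)) (inj₁ c) =
    row-and-column qs (rook-sym pq) (rook-sym ps) r (sym c)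
  rook-triangle pq ps qs (inj₂ (inj₂ r)) (inj₂ (inj₁ c)) =
    row-and-column (rook-sym qs) (rook-sym ps) (rook-sym pq) (sym r) (sym c)
  rook-triangle pq ps qs (inj₂ (inj₂ r)) (inj₂ (inj₂ c)) = proj₂ qs (r , c)

open Rook

module Pairs {T : Set} where

  Incident : T × T → T → Set
  Incident X v = proj₁ X ≡ v ⊎ proj₂ X ≡ v

  Touch : T × T → T × T → Set
  Touch X Y = proj₁ X ≡ proj₁ Y ⊎ proj₁ X ≡ proj₂ Y ⊎ proj₂ X ≡ proj₁ Y ⊎ proj₂ X ≡ proj₂ Y

  LineAdj : T × T → T × T → Set
  LineAdj X Y = X ≢ Y × Touch X Y

  touch? : DecidableEquality T → ∀ X Y → Dec (Touch X Y)
  touch? _≟ᵀ_ X Y = (proj₁ X ≟ᵀ proj₁ Y) ⊎-dec (proj₁ X ≟ᵀ proj₂ Y)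
                  ⊎-dec (proj₂ X ≟ᵀ proj₁ Y) ⊎-dec (proj₂ X ≟ᵀ proj₂ Y)

  common-endpoint : ∀ X Y → Touch X Y → ∃ λ v → Incident X v × Incident Y v
  common-endpoint X Y (inj₁ e)               = proj₁ X , inj₁ refl , inj₁ (sym e)
  common-endpoint X Y (inj₂ (inj₁ e))        = proj₁ X , inj₁ refl , inj₂ (sym e)
  common-endpoint X Y (inj₂ (inj₂ (inj₁ e))) = proj₂ X , inj₂ refl , inj₁ (sym e)
  common-endpoint X Y (inj₂ (inj₂ (inj₂ e))) = proj₂ X , inj₂ refl , inj₂ (sym e)

  touch-at : ∀ X Y {v} → Incident X v → Incident Y v → Touch X Y
  touch-at X Y (inj₁ e) (inj₁ e′) = inj₁ (trans e (sym e′))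
  touch-at X Y (inj₁ e) (inj₂ e′) = inj₂ (inj₁ (trans e (sym e′)))
  touch-at X Y (inj₂ e) (inj₁ e′) = inj₂ (inj₂ (inj₁ (trans e (sym e′))))
  touch-at X Y (inj₂ e) (inj₂ e′) = inj₂ (inj₂ (inj₂ (trans e (sym e′))))

  two-endpoints : ∀ X {a b w} → Incident X a → Incident X b → a ≢ b →
    Incident X w → w ≡ a ⊎ w ≡ b
  two-endpoints X (inj₁ ea) (inj₁ eb) a≢b _ = ⊥-elim (a≢b (trans (sym ea) eb))
  two-endpoints X (inj₁ ea) (inj₂ eb) a≢b (inj₁ ew) = inj₁ (trans (sym ew) ea)
  two-endpoints X (inj₁ ea) (inj₂ eb) a≢b (inj₂ ew) = inj₂ (trans (sym ew) eb)
  two-endpoints X (inj₂ ea) (inj₁ eb) a≢b (inj₁ ew) = inj₂ (trans (sym ew) eb)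
  two-endpoints X (inj₂ ea) (inj₁ eb) a≢b (inj₂ ew) = inj₁ (trans (sym ew) ea)
  two-endpoints X (inj₂ ea) (inj₂ eb) a≢b _ = ⊥-elim (a≢b (trans (sym ea) eb))

  pigeonhole : ∀ A {u v w} → Incident A u → Incident A v → Incident A w → TwoCoincide u v w
  pigeonhole A (inj₁ eu) (inj₁ ev) _ = inj₁ (trans (sym eu) ev)
  pigeonhole A (inj₂ eu) (inj₂ ev) _ = inj₁ (trans (sym eu) ev)
  pigeonhole A (inj₁ eu) (inj₂ ev) (inj₁ ew) = inj₂ (inj₁ (trans (sym eu) ew))
  pigeonhole A (inj₁ eu) (inj₂ ev) (inj₂ ew) = inj₂ (inj₂ (trans (sym ev) ew))
  pigeonhole A (inj₂ eu) (inj₁ ev) (inj₁ ew) = inj₂ (inj₂ (trans (sym ev) ew))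
  pigeonhole A (inj₂ eu) (inj₁ ev) (inj₂ ew) = inj₂ (inj₁ (trans (sym eu) ew))

  -- A pair X meeting the disjoint pairs A and B, with its endpoint α in A
  -- and its endpoint β in B: the cell (α , β) of the grid A × B.
  record Crossing (A B X : T × T) : Set where
    field
      α β : T
      X∋α : Incident X α
      A∋α : Incident A α
      X∋β : Incident X β
      B∋β : Incident B β
      α≢β : α ≢ β

    cell : T × T
    cell = α , β

  crossing : ∀ A B X → ¬ Touch A B → Touch X A → Touch X B → Crossing A B X
  crossing A B X A∤B XA XB with common-endpoint X A XA | common-endpoint X B XB
  ... | α , X∋α , A∋α | β , X∋β , B∋β = record
    { α = α ; β = β ; X∋α = X∋α ; A∋α = A∋α ; X∋β = X∋β ; B∋β = B∋β
    ; α≢β = λ { refl → A∤B (touch-at A B A∋α B∋β) } }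

  crossing-endpoints : ∀ {A B X} (cX : Crossing A B X) {w} → Incident X w →
    w ≡ Crossing.α cX ⊎ w ≡ Crossing.β cX
  crossing-endpoints {X = X} cX = two-endpoints X X∋α X∋β α≢β
    where open Crossing cX

  -- If crossings X and Y share an endpoint, they share it on the same side,
  -- since an endpoint of A equal to one of B would make A and B touch.
  touching-crossings : ∀ {A B X Y} → ¬ Touch A B →
    (cX : Crossing A B X) (cY : Crossing A B Y) → Touch X Y →
    Crossing.α cX ≡ Crossing.α cY ⊎ Crossing.β cX ≡ Crossing.β cY
  touching-crossings {A} {B} {X} {Y} A∤B cX cY XY with common-endpoint X Y XY
  ... | w , X∋w , Y∋w with crossing-endpoints cX X∋w | crossing-endpoints cY Y∋w
  ... | inj₁ w≡αX | inj₁ w≡αY = inj₁ (trans (sym w≡αX) w≡αY)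
  ... | inj₂ w≡βX | inj₂ w≡βY = inj₂ (trans (sym w≡βX) w≡βY)
  ... | inj₁ w≡αX | inj₂ w≡βY =
    ⊥-elim (A∤B (touch-at A B (A∋α cX) (subst (Incident B) (trans (sym w≡βY) w≡αX) (B∋β cY))))
    where open Crossing
  ... | inj₂ w≡βX | inj₁ w≡αY =
    ⊥-elim (A∤B (touch-at A B (A∋α cY) (subst (Incident B) (trans (sym w≡βX) w≡αY) (B∋β cX))))
    where open Crossing

open Pairs

Ordered : {m : ℕ} → Fin m × Fin m → Set
Ordered X = toℕ (proj₁ X) < toℕ (proj₂ X)

ordered-by-endpoints : ∀ {m} (X Y : Fin m × Fin m) → Ordered X → Ordered Y →
  (∀ {w} → Incident X w → Incident Y w) → X ≡ Y
ordered-by-endpoints X Y oX oY X⊆Y with X⊆Y (inj₁ refl) | X⊆Y (inj₂ refl)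
... | inj₁ refl | inj₂ refl = refl
... | inj₁ refl | inj₁ refl = ⊥-elim (<-irrefl refl oX)
... | inj₂ refl | inj₂ refl = ⊥-elim (<-irrefl refl oX)
... | inj₂ refl | inj₁ refl = ⊥-elim (<-asym oX oY)

crossing-rook : ∀ {m} {A B X Y : Fin m × Fin m} → ¬ Touch A B →
  Ordered X → Ordered Y → (cX : Crossing A B X) (cY : Crossing A B Y) →
  LineAdj X Y → RookAdj (Crossing.cell cX) (Crossing.cell cY)
crossing-rook {X = X} {Y} A∤B oX oY cX cY (X≢Y , XY) =
  touching-crossings A∤B cX cY XY , same-cell⇒equal
  where
  open Crossing
  same-cell⇒equal : ¬ (α cX ≡ α cY × β cX ≡ β cY)
  same-cell⇒equal (αX≡αY , βX≡βY) = X≢Y (ordered-by-endpoints X Y oX oY X⊆Y)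
    where
    X⊆Y : ∀ {w} → Incident X w → Incident Y w
    X⊆Y X∋w with crossing-endpoints cX X∋w
    ... | inj₁ refl = subst (Incident Y) (sym αX≡αY) (X∋α cY)
    ... | inj₂ refl = subst (Incident Y) (sym βX≡βY) (X∋β cY)

no-K₅⁻-of-pairs : ∀ {m} (A B X Y Z : Fin m × Fin m) → ¬ Touch A B →
  Ordered X → Ordered Y → Ordered Z →
  Touch X A → Touch X B → Touch Y A → Touch Y B → Touch Z A → Touch Z B →
  LineAdj X Y → LineAdj X Z → LineAdj Y Z → ⊥
no-K₅⁻-of-pairs A B X Y Z A∤B oX oY oZ XA XB YA YB ZA ZB XY XZ YZ =
  rook-triangle (crossing-rook A∤B oX oY cX cY XY)
                (crossing-rook A∤B oX oZ cX cZ XZ)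
                (crossing-rook A∤B oY oZ cY cZ YZ)
                (pigeonhole A (A∋α cX) (A∋α cY) (A∋α cZ))
                (pigeonhole B (B∋β cX) (B∋β cY) (B∋β cZ))
  where
  open Crossing
  cX : Crossing A B X
  cX = crossing A B X A∤B XA XB
  cY : Crossing A B Y
  cY = crossing A B Y A∤B YA YB
  cZ : Crossing A B Z
  cZ = crossing A B Z A∤B ZA ZB

record K₅MinusEdge {N : ℕ} (G : Graph N) : Set where
  field
    p q x y z : Fin N
    p≢q : p ≢ q
    p≁q : ¬ Adj G p q
    x~p : Adj G x p
    x~q : Adj G x q
    y~p : Adj G y p
    y~q : Adj G y q
    z~p : Adj G z p
    z~q : Adj G z q
    x~y : Adj G x y
    x~z : Adj G x z
    y~z : Adj G y z

module LineGraph {N m : ℕ} (G : Graph N) (P : Graph m) (L : IsLineGraphOf G P) where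

  E : Fin N → Fin m × Fin m
  E u = proj₁ (proj₁ L u)

  E-ordered : ∀ u → Ordered (E u)
  E-ordered u = proj₁ (proj₂ (proj₁ L u))

  E-injective : ∀ u v → E u ≡ E v → u ≡ v
  E-injective = proj₁ (proj₂ L)

  adj⇔lineAdj : ∀ u v → Adj G u v ⇔ LineAdj (E u) (E v)
  adj⇔lineAdj = proj₂ (proj₂ (proj₂ L))

  adj⇒touch : ∀ {u v} → Adj G u v → Touch (E u) (E v)
  adj⇒touch {u} {v} u~v = proj₂ (Equivalence.to (adj⇔lineAdj u v) u~v)

  nonadj⇒disjoint : ∀ {u v} → u ≢ v → ¬ Adj G u v → ¬ Touch (E u) (E v)
  nonadj⇒disjoint {u} {v} u≢v u≁v uv =
    u≁v (Equivalence.from (adj⇔lineAdj u v) ((λ e → u≢v (E-injective u v e)) , uv))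

  decAdj : ∀ u v → Dec (Adj G u v)
  decAdj u v = map′ (Equivalence.from (adj⇔lineAdj u v)) (Equivalence.to (adj⇔lineAdj u v))
    (¬? (≡-dec _≟_ _≟_ (E u) (E v)) ×-dec touch? _≟_ (E u) (E v))

  K₅⁻-free : ¬ K₅MinusEdge G
  K₅⁻-free K = no-K₅⁻-of-pairs (E p) (E q) (E x) (E y) (E z)
    (nonadj⇒disjoint p≢q p≁q) (E-ordered x) (E-ordered y) (E-ordered z)
    (adj⇒touch x~p) (adj⇒touch x~q) (adj⇒touch y~p)
    (adj⇒touch y~q) (adj⇒touch z~p) (adj⇒touch z~q)
    (lineAdj x~y) (lineAdj x~z) (lineAdj y~z)
    where
    open K₅MinusEdge K
    lineAdj : ∀ {u v} → Adj G u v → LineAdj (E u) (E v)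
    lineAdj {u} {v} = Equivalence.to (adj⇔lineAdj u v)

record InducedPath₃ {n : ℕ} (Γ : Graph n) : Set where
  field
    p c q : Fin n
    p~c : Adj Γ p c
    c~q : Adj Γ c q
    p≢q : p ≢ q
    p≁q : ¬ Adj Γ p q

-- A walk between distinct non-adjacent vertices passes through an induced
-- path: follow it until the first vertex adjacent to its end.
walk⇒inducedPath₃ : ∀ {n} {Γ : Graph n} → (∀ u v → Dec (Adj Γ u v)) →
  ∀ {u w} → Walk Γ u w → u ≢ w → ¬ Adj Γ u w → InducedPath₃ Γ
walk⇒inducedPath₃ dec here u≢w _ = ⊥-elim (u≢w refl)
walk⇒inducedPath₃ dec {u} {w} (step {v = v} u~v walk) u≢w u≁w with dec v w
... | yes v~w = record { p = u ; c = v ; q = w ; p~c = u~v ; c~q = v~w ; p≢q = u≢w ; p≁q = u≁w }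
... | no v≁w with v ≟ w
...   | yes refl = ⊥-elim (u≁w u~v)
...   | no v≢w = walk⇒inducedPath₃ dec walk v≢w v≁w

some-edge : ∀ {n} → 2 ≤ n → (Λ : Graph n) → Connected Λ → ∃ λ a → ∃ λ b → Adj Λ a b
some-edge (s≤s (s≤s _)) Λ conn with conn fzero (fsuc fzero)
... | step {v = v} 0~v _ = fzero , v , 0~v

record JoinEmbedding {N n m : ℕ} (G : Graph N) (Γ : Graph n) (Λ : Graph m) : Set where
  field
    ι₁ : Fin n → Fin N
    ι₂ : Fin m → Fin N
    ι₁-injective : ∀ {i j} → ι₁ i ≡ ι₁ j → i ≡ j
    ι₂-injective : ∀ {i j} → ι₂ i ≡ ι₂ j → i ≡ j
    ι₁-adj : ∀ i j → Adj G (ι₁ i) (ι₁ j) ⇔ Adj Γ i j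
    ι₂-adj : ∀ i j → Adj G (ι₂ i) (ι₂ j) ⇔ Adj Λ i j
    cross : ∀ i j → Adj G (ι₁ i) (ι₂ j)

swap : ∀ {N n m} {G : Graph N} {Γ : Graph n} {Λ : Graph m} →
  JoinEmbedding G Γ Λ → JoinEmbedding G Λ Γ
swap {G = G} J = record
  { ι₁ = ι₂ ; ι₂ = ι₁ ; ι₁-injective = ι₂-injective ; ι₂-injective = ι₁-injective
  ; ι₁-adj = ι₂-adj ; ι₂-adj = ι₁-adj ; cross = λ i j → Graph.sym G (cross j i) }
  where open JoinEmbedding J

join-adj : ∀ {n m} (Γ : Graph n) (Λ : Graph m) {u v x y} →
  splitAt n u ≡ x → splitAt n v ≡ y → Adj (Γ ∨ᴳ Λ) u v ⇔ JoinAdj Γ Λ x y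
join-adj Γ Λ refl refl = mk⇔ (λ a → a) (λ a → a)

join-embedding : ∀ {n m} (Γ : Graph n) (Λ : Graph m) → JoinEmbedding (Γ ∨ᴳ Λ) Γ Λ
join-embedding {n} {m} Γ Λ = record
  { ι₁ = _↑ˡ m
  ; ι₂ = n ↑ʳ_
  ; ι₁-injective = ↑ˡ-injective m _ _
  ; ι₂-injective = ↑ʳ-injective n _ _
  ; ι₁-adj = λ i j → join-adj Γ Λ (splitAt-↑ˡ n i m) (splitAt-↑ˡ n j m)
  ; ι₂-adj = λ i j → join-adj Γ Λ (splitAt-↑ʳ n m i) (splitAt-↑ʳ n m j)
  ; cross = λ i j → Equivalence.from (join-adj Γ Λ (splitAt-↑ˡ n i m) (splitAt-↑ʳ n m j)) _
  }

module _ {N n m : ℕ} {G : Graph N} {Γ : Graph n} {Λ : Graph m} (J : JoinEmbedding G Γ Λ) where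
  open JoinEmbedding J

  first-factor-dec : (∀ u v → Dec (Adj G u v)) → ∀ u v → Dec (Adj Γ u v)
  first-factor-dec decG u v =
    map′ (Equivalence.to (ι₁-adj u v)) (Equivalence.from (ι₁-adj u v)) (decG (ι₁ u) (ι₁ v))

  inducedPath⇒K₅⁻ : InducedPath₃ Γ → ∀ {z x} → Adj Λ z x → K₅MinusEdge G
  inducedPath⇒K₅⁻ path {z} {x} z~x = record
    { p = ι₁ p ; q = ι₁ q ; x = ι₁ c ; y = ι₂ z ; z = ι₂ x
    ; p≢q = λ e → p≢q (ι₁-injective e)
    ; p≁q = λ a → p≁q (Equivalence.to (ι₁-adj p q) a)
    ; x~p = Equivalence.from (ι₁-adj c p) (Graph.sym Γ p~c)
    ; x~q = Equivalence.from (ι₁-adj c q) c~q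
    ; y~p = Graph.sym G (cross p z) ; y~q = Graph.sym G (cross q z)
    ; z~p = Graph.sym G (cross p x) ; z~q = Graph.sym G (cross q x)
    ; x~y = cross c z ; x~z = cross c x
    ; y~z = Equivalence.from (ι₂-adj z x) z~x
    }
    where open InducedPath₃ path

  -- If G has decidable adjacency and no K₅ minus an edge, Γ is connected and
  -- Λ has an edge, then Γ is complete: a non-edge of Γ would give an induced
  -- path of Γ, hence a K₅ minus an edge in G.
  K₅⁻-free⇒complete : (∀ u v → Dec (Adj G u v)) → ¬ K₅MinusEdge G →
    Connected Γ → (∃ λ a → ∃ λ b → Adj Λ a b) → IsComplete Γ
  K₅⁻-free⇒complete decG free connΓ (z , x , z~x) i j i≢j
    with first-factor-dec decG i j
  ... | yes i~j = i~j
  ... | no i≁j = ⊥-elim (free (inducedPath⇒K₅⁻ path z~x))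
    where
    path : InducedPath₃ Γ
    path = walk⇒inducedPath₃ (first-factor-dec decG) (connΓ i j) i≢j i≁j

proposition4p15 : (n : ℕ) → 3 ≤ n → (Γ Λ : Graph n) →
    Connected Γ → Connected Λ → ¬ (IsComplete Γ × IsComplete Λ) →
    ¬ IsLineGraph (Γ ∨ᴳ Λ)
proposition4p15 n 3≤n Γ Λ connΓ connΛ notBoth (m , P , L) =
  notBoth ( K₅⁻-free⇒complete J decAdj K₅⁻-free connΓ (some-edge 2≤n Λ connΛ)
          , K₅⁻-free⇒complete (swap J) decAdj K₅⁻-free connΛ (some-edge 2≤n Γ connΓ))
  where
  open LineGraph (Γ ∨ᴳ Λ) P L
  J : JoinEmbedding (Γ ∨ᴳ Λ) Γ Λ
  J = join-embedding Γ Λ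
  2≤n : 2 ≤ n
  2≤n = ≤-trans (n≤1+n 2) 3≤n
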